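{- There exists a one-pass streaming algorithm for \textsc{PartB}, requiring no advance knowledge of $m$, $n$ or $S$, that is a $2$-approximation and uses $\mathrm{O}(\log(mn))$ bits of space.
   Context: Problem: the input is a stream $X=(X_1,\dots,X_n)\in\{0,1,\dots,m\}^n$ of length $n$ whose maximum element is $m$, together with an integer $p\ge 2$ stored in memory. A partitioning is given by separators $1=s_0\le s_1\le\dots\le s_{p-1}\le s_p=n+1$; its bottleneck value is $\max_{0\le j\le p-1}\sum_{i=s_j}^{s_{j+1}-1}X_i$. $B^*$ denotes the minimum bottleneck value over all partitionings, and $S=\sum_iX_i$. In \textsc{PartB} the algorithm must output a value $B$ with $B\ge B^*$; it is a $2$-approximation if moreover $B\le 2B^*$. -}

module Defs where

open import Data.Nat using (ℕ; zero; suc; _+_; _*_; _∸_; _≤_; _<_; _⊔_)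
open import Data.Nat.Logarithm using (⌊log₂_⌋)
open import Data.Bool using (Bool)
open import Data.Nat.ListAction using (sum)
open import Data.List using (List; []; _∷_; take; drop; length; foldl; foldr; map; upTo)
open import Relation.Binary.PropositionalEquality using (_≡_)

-- The stream X = (X_1,...,X_n) is a list; X_i is the element at list position i-1.

-- Sum X_a + ... + X_{b-1} (block of 1-based indices [a, b); empty if b ≤ a).
blockSum : List ℕ → ℕ → ℕ → ℕ
blockSum xs a b = sum (take (b ∸ a) (drop (a ∸ 1) xs))

maxElem : List ℕ → ℕ
maxElem = foldr _⊔_ 0

-- A partitioning of a stream of length n into p parts: separators
-- s_0, ..., s_p (values of sep at indices > p are irrelevant) with
-- 1 = s_0 ≤ s_1 ≤ ... ≤ s_p = n + 1.
record Partitioning (p n : ℕ) : Set where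
  field
    sep       : ℕ → ℕ
    sep-first : sep 0 ≡ 1
    sep-last  : sep p ≡ suc n
    sep-mono  : ∀ j → j < p → sep j ≤ sep (suc j)
open Partitioning public

bottleneck : (p : ℕ) (xs : List ℕ) → Partitioning p (length xs) → ℕ
bottleneck p xs P =
  foldr _⊔_ 0 (map (λ j → blockSum xs (sep P j) (sep P (suc j))) (upTo p))

-- "B ≥ B*": some partitioning achieves bottleneck ≤ B
-- (B* is the minimum bottleneck over all partitionings).
AtLeastOpt : (p : ℕ) (xs : List ℕ) (B : ℕ) → Set
AtLeastOpt p xs B = Σ' (Partitioning p (length xs)) (λ P → bottleneck p xs P ≤ B)
  where
    open import Data.Product using () renaming (Σ to Σ')

-- "B ≤ 2 B*": B ≤ 2 · bottleneck for every partitioning.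
AtMostTwiceOpt : (p : ℕ) (xs : List ℕ) (B : ℕ) → Set
AtMostTwiceOpt p xs B = (P : Partitioning p (length xs)) → B ≤ 2 * bottleneck p xs P

-- The
-- integer p is given as a read-only parameter available to every step.
-- The algorithm is a single object, independent of m, n and S (it has no
-- advance knowledge of them).

record StreamAlg : Set where
  field
    init   : ℕ → List Bool
    step   : ℕ → List Bool → ℕ → List Bool  -- p, memory, next item ↦ new memory
    output : ℕ → List Bool → ℕ
open StreamAlg public

memAfter : StreamAlg → ℕ → List ℕ → List Bool
memAfter A p xs = foldl (step A p) (init A p) xs

answer : StreamAlg → ℕ → List ℕ → ℕ
answer A p xs = output A p (memAfter A p xs)

-- Space bound O(log(mn)) bits, with constant c: at every moment of the
-- pass (after each prefix of length k ≤ n, including k = 0) the memory has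
-- at most c · (⌊log₂(m+1)⌋ + ⌊log₂(n+1)⌋ + 1) bits.
SpaceBound : StreamAlg → ℕ → ℕ → List ℕ → Set
SpaceBound A c p xs =
  ∀ k → k ≤ length xs →
    length (memAfter A p (take k xs))
      ≤ c * (⌊log₂ (suc (maxElem xs)) ⌋ + ⌊log₂ (suc (length xs)) ⌋ + 1)

module Submission where

-- The algorithm keeps only the running sum S and the running maximum M of
-- the stream, each stored in binary with a self-delimiting code, and at the
-- end outputs  B = ⌈S/p⌉ + M.  Since S ≤ mn, the memory is O(log(mn)) bits.
--
-- Both approximation guarantees are statements about the pair (S, M):
--  * lower bound: every partitioning into p blocks has bottleneck B' with
--    S ≤ p·B' (the blocks cover the stream) and M ≤ B' (the largest item
--    lies in some block), hence ⌈S/p⌉ + M ≤ 2B';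
--  * upper bound: for any T with S ≤ p·T, cutting the stream greedily at
--    the prefix sums T, 2T, …, pT gives a partitioning whose blocks all
--    have sum ≤ T + M; with T = ⌈S/p⌉ this shows B ≥ B*.

open import Defs
open import Data.Nat
open import Data.Nat.Properties
open import Data.Nat.DivMod using (_/_; _%_; m≡m%n+[m/n]*n; m%n<n; m<n*o⇒m/o<n)
open import Data.Nat.Logarithm using (⌊log₂_⌋; ⌊log₂⌋-mono-≤; ⌊log₂[2^n]⌋≡n)
open import Data.Nat.ListAction using (sum)
open import Data.Nat.ListAction.Properties using (sum-++)
open import Data.Nat.Binary.Base as Bin using (ℕᵇ; size)
open import Data.Nat.Binary.Properties using (toℕ-fromℕ)
open import Data.Nat.Tactic.RingSolver using (solve-∀)
open import Data.List using (List; []; _∷_; _++_; take; drop; length; foldl; foldr; map; upTo)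
open import Data.List.Properties using (take-all; take-[]; drop-all; ++-identityʳ; length-++)
open import Data.List.Membership.Propositional using (_∈_)
open import Data.List.Membership.Propositional.Properties using (∈-map⁺; ∈-map⁻; ∈-upTo⁺; ∈-upTo⁻)
open import Data.List.Relation.Unary.Any using (here; there)
open import Data.Bool using (Bool; true; false)
open import Data.Product using (Σ; _×_; _,_; proj₁; proj₂; map₁)
open import Relation.Binary.PropositionalEquality
open import Function using (_∘_)
open import Relation.Nullary using (yes; no; contradiction)

-- Being
-- prefix-free, codes can be concatenated and read back one after another.
codeᵇ : ℕᵇ → List Bool
codeᵇ Bin.zero     = false ∷ []
codeᵇ Bin.2[1+ x ] = true ∷ true ∷ codeᵇ x
codeᵇ Bin.1+[2 x ] = true ∷ false ∷ codeᵇ x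

decodeᵇ : List Bool → ℕᵇ × List Bool
decodeᵇ []                 = Bin.zero , []
decodeᵇ (false ∷ rest)     = Bin.zero , rest
decodeᵇ (true ∷ [])        = Bin.zero , []
decodeᵇ (true ∷ true ∷ r)  = map₁ Bin.2[1+_] (decodeᵇ r)
decodeᵇ (true ∷ false ∷ r) = map₁ Bin.1+[2_] (decodeᵇ r)

decodeᵇ-codeᵇ : ∀ x rest → decodeᵇ (codeᵇ x ++ rest) ≡ (x , rest)
decodeᵇ-codeᵇ Bin.zero     rest = refl
decodeᵇ-codeᵇ Bin.2[1+ x ] rest = cong (map₁ Bin.2[1+_]) (decodeᵇ-codeᵇ x rest)
decodeᵇ-codeᵇ Bin.1+[2 x ] rest = cong (map₁ Bin.1+[2_]) (decodeᵇ-codeᵇ x rest)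

length-codeᵇ : ∀ x → length (codeᵇ x) ≡ suc (size x + size x)
length-codeᵇ Bin.zero     = refl
length-codeᵇ Bin.2[1+ x ] = cong (2 +_) (trans (length-codeᵇ x) (sym (+-suc (size x) (size x))))
length-codeᵇ Bin.1+[2 x ] = cong (2 +_) (trans (length-codeᵇ x) (sym (+-suc (size x) (size x))))

size-bound : ∀ x k → Bin.toℕ x < 2 ^ k → size x ≤ k
size-bound Bin.zero     k       _  = z≤n
size-bound Bin.2[1+ x ] zero    (s≤s ())
size-bound Bin.2[1+ x ] (suc k) lt =
  s≤s (size-bound x k (<⇒≤ (*-cancelˡ-< 2 (suc (Bin.toℕ x)) (2 ^ k) lt)))
size-bound Bin.1+[2 x ] zero    (s≤s ())
size-bound Bin.1+[2 x ] (suc k) lt =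
  s≤s (size-bound x k (*-cancelˡ-< 2 (Bin.toℕ x) (2 ^ k) (<⇒≤ lt)))

size-fromℕ : ∀ {a} k → a < 2 ^ k → size (Bin.fromℕ a) ≤ k
size-fromℕ {a} k lt = size-bound (Bin.fromℕ a) k (subst (_< 2 ^ k) (sym (toℕ-fromℕ a)) lt)

encode : ℕ × ℕ → List Bool
encode (a , b) = codeᵇ (Bin.fromℕ a) ++ codeᵇ (Bin.fromℕ b)

decode : List Bool → ℕ × ℕ
decode bits = Bin.toℕ (proj₁ first) , Bin.toℕ (proj₁ (decodeᵇ (proj₂ first)))
  where
    first : ℕᵇ × List Bool
    first = decodeᵇ bits

decode-encode : ∀ st → decode (encode st) ≡ st
decode-encode (a , b)
  rewrite decodeᵇ-codeᵇ (Bin.fromℕ a) (codeᵇ (Bin.fromℕ b))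
        | sym (++-identityʳ (codeᵇ (Bin.fromℕ b)))
        | decodeᵇ-codeᵇ (Bin.fromℕ b) []
        | toℕ-fromℕ a | toℕ-fromℕ b = refl

length-encode : ∀ a b → length (encode (a , b)) ≡
  suc (size (Bin.fromℕ a) + size (Bin.fromℕ a)) + suc (size (Bin.fromℕ b) + size (Bin.fromℕ b))
length-encode a b =
  trans (length-++ (codeᵇ (Bin.fromℕ a)))
        (cong₂ _+_ (length-codeᵇ (Bin.fromℕ a)) (length-codeᵇ (Bin.fromℕ b)))

-- Ceiling division ⌈s/p⌉ (taken to be 0 when p = 0).
ceilDiv : ℕ → ℕ → ℕ
ceilDiv s zero    = 0
ceilDiv s (suc q) = (s + q) / suc q

ceilDiv-least : ∀ q s b → s ≤ suc q * b → ceilDiv s (suc q) ≤ b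
ceilDiv-least q s b s≤pb = s≤s⁻¹ (m<n*o⇒m/o<n {s + q} {suc b} {suc q} (s≤s (begin
  s + q         ≤⟨ +-monoˡ-≤ q s≤pb ⟩
  suc q * b + q ≡⟨ cong (_+ q) (*-comm (suc q) b) ⟩
  b * suc q + q ≡⟨ +-comm (b * suc q) q ⟩
  q + b * suc q ∎)))
  where open ≤-Reasoning

ceilDiv-covers : ∀ q s → s ≤ suc q * ceilDiv s (suc q)
ceilDiv-covers q s = +-cancelˡ-≤ q s (suc q * t) (begin
  q + s                       ≡⟨ +-comm q s ⟩
  s + q                       ≡⟨ m≡m%n+[m/n]*n (s + q) (suc q) ⟩
  (s + q) % suc q + t * suc q ≤⟨ +-monoˡ-≤ (t * suc q) (s≤s⁻¹ (m%n<n (s + q) (suc q))) ⟩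
  q + t * suc q               ≡⟨ cong (q +_) (*-comm t (suc q)) ⟩
  q + suc q * t               ∎)
  where
    open ≤-Reasoning
    t : ℕ
    t = ceilDiv s (suc q)

update : ℕ × ℕ → ℕ → ℕ × ℕ
update (s , m) x = s + x , m ⊔ x

estimate : ℕ → ℕ × ℕ → ℕ
estimate p (s , m) = ceilDiv s p + m

partB : StreamAlg
partB = record
  { init   = λ _ → encode (0 , 0)
  ; step   = λ _ bits x → encode (update (decode bits) x)
  ; output = λ p bits → estimate p (decode bits)
  }

run-encoded : ∀ p st xs → foldl (step partB p) (encode st) xs ≡ encode (foldl update st xs)
run-encoded p st []       = refl
run-encoded p st (x ∷ xs) =
  trans (cong (λ st′ → foldl (step partB p) (encode (update st′ x)) xs) (decode-encode st))
        (run-encoded p (update st x) xs)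

run-update : ∀ s m xs → foldl update (s , m) xs ≡ (s + sum xs , m ⊔ maxElem xs)
run-update s m []       = cong₂ _,_ (sym (+-identityʳ s)) (sym (⊔-identityʳ m))
run-update s m (x ∷ xs) = trans (run-update (s + x) (m ⊔ x) xs)
  (cong₂ _,_ (+-assoc s x (sum xs)) (⊔-assoc m x (maxElem xs)))

memAfter-partB : ∀ p xs → memAfter partB p xs ≡ encode (sum xs , maxElem xs)
memAfter-partB p xs = trans (run-encoded p (0 , 0) xs) (cong encode (run-update 0 0 xs))

answer-partB : ∀ p xs → answer partB p xs ≡ ceilDiv (sum xs) p + maxElem xs
answer-partB p xs = begin
  estimate p (decode (memAfter partB p xs))          ≡⟨ cong (estimate p ∘ decode) (memAfter-partB p xs) ⟩
  estimate p (decode (encode (sum xs , maxElem xs))) ≡⟨ cong (estimate p) (decode-encode _) ⟩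
  ceilDiv (sum xs) p + maxElem xs ∎
  where open ≡-Reasoning

-- Space.  Every prefix has sum < 2^(⌊log₂(m+1)⌋+1) · 2^(⌊log₂(n+1)⌋+1)
-- and maximum < 2^(⌊log₂(m+1)⌋+1), so both codes have O(log(mn)) bits.

<2^suc⌊log₂⌋ : ∀ a → a < 2 ^ suc ⌊log₂ a ⌋
<2^suc⌊log₂⌋ a with a <? 2 ^ suc ⌊log₂ a ⌋
... | yes lt = lt
... | no ≮ = contradiction log-too-big (1+n≰n)
  where
    log-too-big : suc ⌊log₂ a ⌋ ≤ ⌊log₂ a ⌋
    log-too-big = subst (_≤ ⌊log₂ a ⌋) (⌊log₂[2^n]⌋≡n (suc ⌊log₂ a ⌋)) (⌊log₂⌋-mono-≤ (≮⇒≥ ≮))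

sum≤length*max : ∀ xs → sum xs ≤ length xs * maxElem xs
sum≤length*max []       = z≤n
sum≤length*max (x ∷ xs) = +-mono-≤ (m≤m⊔n x (maxElem xs))
  (≤-trans (sum≤length*max xs) (*-monoʳ-≤ (length xs) (m≤n⊔m x (maxElem xs))))

sum-take≤ : ∀ k xs → sum (take k xs) ≤ sum xs
sum-take≤ zero    xs       = z≤n
sum-take≤ (suc k) []       = z≤n
sum-take≤ (suc k) (x ∷ xs) = +-monoʳ-≤ x (sum-take≤ k xs)

maxElem-take≤ : ∀ k xs → maxElem (take k xs) ≤ maxElem xs
maxElem-take≤ zero    xs       = z≤n
maxElem-take≤ (suc k) []       = z≤n
maxElem-take≤ (suc k) (x ∷ xs) = ⊔-monoʳ-≤ x (maxElem-take≤ k xs)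

module SpaceBounds (xs : List ℕ) where
  logm logn : ℕ
  logm = ⌊log₂ (suc (maxElem xs)) ⌋
  logn = ⌊log₂ (suc (length xs)) ⌋

  sum< : sum xs < 2 ^ (suc logm + suc logn)
  sum< = begin-strict
    sum xs                            ≤⟨ sum≤length*max xs ⟩
    length xs * maxElem xs            ≡⟨ *-comm (length xs) (maxElem xs) ⟩
    maxElem xs * length xs            <⟨ *-mono-< (n<1+n (maxElem xs)) (n<1+n (length xs)) ⟩
    suc (maxElem xs) * suc (length xs) ≤⟨ *-mono-≤ (<⇒≤ (<2^suc⌊log₂⌋ (suc (maxElem xs))))
                                                   (<⇒≤ (<2^suc⌊log₂⌋ (suc (length xs)))) ⟩
    2 ^ suc logm * 2 ^ suc logn       ≡⟨ ^-distribˡ-+-* 2 (suc logm) (suc logn) ⟨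
    2 ^ (suc logm + suc logn)         ∎
    where open ≤-Reasoning

  max< : maxElem xs < 2 ^ suc logm
  max< = ≤-<-trans (n≤1+n (maxElem xs)) (<2^suc⌊log₂⌋ (suc (maxElem xs)))

  codes-fit : ∀ {da db} → da ≤ suc logm + suc logn → db ≤ suc logm →
              suc (da + da) + suc (db + db) ≤ 8 * (logm + logn + 1)
  codes-fit {da} {db} da≤ db≤ = begin
    suc (da + da) + suc (db + db)   ≤⟨ +-mono-≤ (s≤s (+-mono-≤ da≤ da≤)) (s≤s (+-mono-≤ db≤ db≤)) ⟩
    worst                           ≤⟨ m≤m+n worst (4 * logm + 6 * logn) ⟩
    worst + (4 * logm + 6 * logn)   ≡⟨ expand logm logn ⟨
    8 * (logm + logn + 1)           ∎
    where
      open ≤-Reasoning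
      worst : ℕ
      worst = suc ((suc logm + suc logn) + (suc logm + suc logn)) + suc (suc logm + suc logm)
      expand : ∀ a b → 8 * (a + b + 1) ≡
        (suc ((suc a + suc b) + (suc a + suc b)) + suc (suc a + suc a)) + (4 * a + 6 * b)
      expand = solve-∀

partB-space : ∀ p xs → SpaceBound partB 8 p xs
partB-space p xs k _ = begin
  length (memAfter partB p (take k xs))                 ≡⟨ cong length (memAfter-partB p (take k xs)) ⟩
  length (encode (sum (take k xs) , maxElem (take k xs))) ≡⟨ length-encode (sum (take k xs)) (maxElem (take k xs)) ⟩
  _                                                     ≤⟨ codes-fit (size-fromℕ (suc logm + suc logn) sum-prefix<)
                                                                   (size-fromℕ (suc logm) max-prefix<) ⟩
  8 * (logm + logn + 1)                                 ∎
  where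
    open ≤-Reasoning
    open SpaceBounds xs
    sum-prefix< : sum (take k xs) < 2 ^ (suc logm + suc logn)
    sum-prefix< = ≤-<-trans (sum-take≤ k xs) sum<
    max-prefix< : maxElem (take k xs) < 2 ^ suc logm
    max-prefix< = ≤-<-trans (maxElem-take≤ k xs) max<

segment : List ℕ → ℕ → ℕ → List ℕ
segment xs a b = take (b ∸ a) (drop (a ∸ 1) xs)

take-split : ∀ {a b} (xs : List ℕ) → a ≤ b → take a xs ++ take (b ∸ a) (drop a xs) ≡ take b xs
take-split {zero}              xs       _         = refl
take-split {suc a} {suc b}     []       _         = take-[] (b ∸ a)
take-split {suc a} {suc b}     (x ∷ xs) (s≤s a≤b) = cong (x ∷_) (take-split xs a≤b)

prefix-split : ∀ xs {a b} → 1 ≤ a → a ≤ b → segment xs 1 a ++ segment xs a b ≡ segment xs 1 b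
prefix-split xs {suc a} {suc b} _ (s≤s a≤b) = take-split xs a≤b

maxElem-++ : ∀ ys zs → maxElem (ys ++ zs) ≡ maxElem ys ⊔ maxElem zs
maxElem-++ []       zs = refl
maxElem-++ (y ∷ ys) zs = trans (cong (y ⊔_) (maxElem-++ ys zs)) (sym (⊔-assoc y _ _))

maxElem≤sum : ∀ xs → maxElem xs ≤ sum xs
maxElem≤sum []       = z≤n
maxElem≤sum (x ∷ xs) = ≤-trans (⊔-monoʳ-≤ x (maxElem≤sum xs)) (m⊔n≤m+n x (sum xs))

maxUpTo : (ℕ → ℕ) → ℕ → ℕ
maxUpTo f p = foldr _⊔_ 0 (map f (upTo p))

≤-maxUpTo : ∀ f {p j} → j < p → f j ≤ maxUpTo f p
≤-maxUpTo f j<p = ∈⇒≤ (∈-map⁺ f (∈-upTo⁺ j<p))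
  where
    ∈⇒≤ : ∀ {y ys} → y ∈ ys → y ≤ foldr _⊔_ 0 ys
    ∈⇒≤ {ys = z ∷ zs} (here refl) = m≤m⊔n z _
    ∈⇒≤ {ys = z ∷ zs} (there y∈)  = ≤-trans (∈⇒≤ y∈) (m≤n⊔m z _)

maxUpTo-≤ : ∀ f p {b} → (∀ j → j < p → f j ≤ b) → maxUpTo f p ≤ b
maxUpTo-≤ f p {b} bounded = lub (map f (upTo p)) (λ y∈ → member≤ (∈-map⁻ f y∈))
  where
    member≤ : ∀ {y} → Σ ℕ (λ j → j ∈ upTo p × y ≡ f j) → y ≤ b
    member≤ (j , j∈ , refl) = bounded j (∈-upTo⁻ j∈)
    lub : ∀ ys → (∀ {y} → y ∈ ys → y ≤ b) → foldr _⊔_ 0 ys ≤ b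
    lub []       _   = z≤n
    lub (y ∷ ys) all = ⊔-lub (all (here refl)) (lub ys (all ∘ there))

module LowerBound {p : ℕ} (xs : List ℕ) (P : Partitioning p (length xs)) where
  β : ℕ
  β = bottleneck p xs P

  s : ℕ → ℕ
  s = sep P

  sep-positive : ∀ j → j ≤ p → 1 ≤ s j
  sep-positive zero    _   = ≤-reflexive (sym (sep-first P))
  sep-positive (suc j) j<p = ≤-trans (sep-positive j (<⇒≤ j<p)) (sep-mono P j j<p)

  prefix : ℕ → List ℕ
  prefix j = segment xs 1 (s j)

  block : ℕ → List ℕ
  block j = segment xs (s j) (s (suc j))

  block≤β : ∀ j → j < p → sum (block j) ≤ β
  block≤β j = ≤-maxUpTo (λ j → blockSum xs (s j) (s (suc j)))

  prefix-suc : ∀ j → j < p → prefix (suc j) ≡ prefix j ++ block j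
  prefix-suc j j<p = sym (prefix-split xs (sep-positive j (<⇒≤ j<p)) (sep-mono P j j<p))

  prefix-zero : prefix 0 ≡ []
  prefix-zero = cong (λ a → segment xs 1 a) (sep-first P)

  prefix-last : prefix p ≡ xs
  prefix-last = trans (cong (λ b → segment xs 1 b) (sep-last P)) (take-all (length xs) xs ≤-refl)

  prefix-sum≤ : ∀ j → j ≤ p → sum (prefix j) ≤ j * β
  prefix-sum≤ zero    _   = subst (λ ys → sum ys ≤ 0) (sym prefix-zero) z≤n
  prefix-sum≤ (suc j) j<p = begin
    sum (prefix (suc j))           ≡⟨ cong sum (prefix-suc j j<p) ⟩
    sum (prefix j ++ block j)      ≡⟨ sum-++ (prefix j) (block j) ⟩
    sum (prefix j) + sum (block j) ≤⟨ +-mono-≤ (prefix-sum≤ j (<⇒≤ j<p)) (block≤β j j<p) ⟩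
    j * β + β                      ≡⟨ +-comm (j * β) β ⟩
    suc j * β                      ∎
    where open ≤-Reasoning

  prefix-max≤ : ∀ j → j ≤ p → maxElem (prefix j) ≤ β
  prefix-max≤ zero    _   = subst (λ ys → maxElem ys ≤ β) (sym prefix-zero) z≤n
  prefix-max≤ (suc j) j<p = begin
    maxElem (prefix (suc j))               ≡⟨ cong maxElem (prefix-suc j j<p) ⟩
    maxElem (prefix j ++ block j)          ≡⟨ maxElem-++ (prefix j) (block j) ⟩
    maxElem (prefix j) ⊔ maxElem (block j) ≤⟨ ⊔-lub (prefix-max≤ j (<⇒≤ j<p))
                                                    (≤-trans (maxElem≤sum (block j)) (block≤β j j<p)) ⟩
    β                                      ∎
    where open ≤-Reasoning

  sum≤p*β : sum xs ≤ p * β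
  sum≤p*β = subst (λ ys → sum ys ≤ p * β) prefix-last (prefix-sum≤ p ≤-refl)

  maxElem≤β : maxElem xs ≤ β
  maxElem≤β = subst (λ ys → maxElem ys ≤ β) prefix-last (prefix-max≤ p ≤-refl)

fits : ℕ → List ℕ → ℕ
fits y []       = 0
fits y (x ∷ xs) with x ≤? y
... | yes _ = suc (fits (y ∸ x) xs)
... | no  _ = 0

fits-sum≤ : ∀ y xs → sum (take (fits y xs) xs) ≤ y
fits-sum≤ y []       = z≤n
fits-sum≤ y (x ∷ xs) with x ≤? y
... | yes x≤y = ≤-trans (+-monoʳ-≤ x (fits-sum≤ (y ∸ x) xs)) (≤-reflexive (m+[n∸m]≡n x≤y))
... | no  _   = z≤n

fits-maximal : ∀ y xs → fits y xs < length xs → y < sum (take (suc (fits y xs)) xs)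
fits-maximal y (x ∷ xs) fits< with x ≤? y
... | yes x≤y = begin-strict
  y                                       ≡⟨ m+[n∸m]≡n x≤y ⟨
  x + (y ∸ x)                             <⟨ +-monoʳ-< x (fits-maximal (y ∸ x) xs (s≤s⁻¹ fits<)) ⟩
  x + sum (take (suc (fits (y ∸ x) xs)) xs) ∎
  where open ≤-Reasoning
... | no  x≰y = ≤-trans (≰⇒> x≰y) (m≤m+n x 0)

fits-mono : ∀ {y y′} xs → y ≤ y′ → fits y xs ≤ fits y′ xs
fits-mono {y} {y′} []       _    = z≤n
fits-mono {y} {y′} (x ∷ xs) y≤y′ with x ≤? y | x ≤? y′
... | yes _   | yes _    = s≤s (fits-mono xs (∸-monoˡ-≤ x y≤y′))
... | yes x≤y | no  x≰y′ = contradiction (≤-trans x≤y y≤y′) x≰y′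
... | no  _   | _        = z≤n

fits-all : ∀ y xs → sum xs ≤ y → fits y xs ≡ length xs
fits-all y []       _      = refl
fits-all y (x ∷ xs) sum≤y with x ≤? y
... | yes _   = cong suc (fits-all (y ∸ x) xs
                  (≤-trans (≤-reflexive (sym (m+n∸m≡n x (sum xs)))) (∸-monoˡ-≤ x sum≤y)))
... | no  x≰y = contradiction (≤-trans (m≤m+n x (sum xs)) sum≤y) x≰y

sum-take-suc≤ : ∀ k xs → sum (take (suc k) xs) ≤ sum (take k xs) + maxElem xs
sum-take-suc≤ k       []       = z≤n
sum-take-suc≤ zero    (x ∷ xs) = ≤-trans (≤-reflexive (+-identityʳ x)) (m≤m⊔n x _)
sum-take-suc≤ (suc k) (x ∷ xs) = begin
  x + sum (take (suc k) xs)                ≤⟨ +-monoʳ-≤ x (sum-take-suc≤ k xs) ⟩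
  x + (sum (take k xs) + maxElem xs)       ≡⟨ +-assoc x _ _ ⟨
  x + sum (take k xs) + maxElem xs         ≤⟨ +-monoʳ-≤ (x + sum (take k xs)) (m≤n⊔m x _) ⟩
  x + sum (take k xs) + (x ⊔ maxElem xs)   ∎
  where open ≤-Reasoning

sum-past-end : ∀ xs {c} k → length xs ≤ c → sum (take k (drop c xs)) ≡ 0
sum-past-end xs {c} k n≤c =
  trans (cong (λ ys → sum (take k ys)) (drop-all c xs n≤c)) (cong sum (take-[] k))

-- A greedy block [c, c′) has sum ≤ T + M when the prefix up to c′ has sum
-- ≤ T + y while, unless the list is exhausted, the item at c pushes the
-- prefix sum above y (so the prefix up to c already has sum ≥ y − M).
greedy-block : ∀ xs {c c′ T y} → c ≤ c′ → sum (take c′ xs) ≤ T + y →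
  (c < length xs → y < sum (take (suc c) xs)) →
  sum (take (c′ ∸ c) (drop c xs)) ≤ T + maxElem xs
greedy-block xs {c} {c′} {T} {y} c≤c′ upper maximal with c <? length xs
... | no  c≮n = ≤-trans (≤-reflexive (sum-past-end xs (c′ ∸ c) (≮⇒≥ c≮n))) z≤n
... | yes c<n = +-cancelˡ-≤ before blk (T + maxElem xs) (begin
  before + blk                ≡⟨ sum-++ (take c xs) _ ⟨
  sum (take c xs ++ _)        ≡⟨ cong sum (take-split xs c≤c′) ⟩
  sum (take c′ xs)            ≤⟨ upper ⟩
  T + y                       ≤⟨ +-monoʳ-≤ T (<⇒≤ (<-≤-trans (maximal c<n) (sum-take-suc≤ c xs))) ⟩
  T + (before + maxElem xs)   ≡⟨ +-assoc T before _ ⟨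
  T + before + maxElem xs     ≡⟨ cong (_+ maxElem xs) (+-comm T before) ⟩
  before + T + maxElem xs     ≡⟨ +-assoc before T _ ⟩
  before + (T + maxElem xs)   ∎)
  where
    open ≤-Reasoning
    before blk : ℕ
    before = sum (take c xs)
    blk    = sum (take (c′ ∸ c) (drop c xs))

-- Upper bound: if S ≤ p·T, cutting after the longest prefixes of sum
-- ≤ T, 2T, …, pT yields p blocks (the last cut is the end of the stream,
-- since S ≤ pT), each of sum ≤ T + M.  Cut j is at the 1-based position
-- following the j-th prefix.
module Greedy (q : ℕ) (xs : List ℕ) (T : ℕ) (S≤pT : sum xs ≤ suc q * T) where
  M : ℕ
  M = maxElem xs

  cut : ℕ → ℕ
  cut zero    = 1
  cut (suc j) = suc (fits (suc j * T) xs)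

  cut-mono : ∀ j → j < suc q → cut j ≤ cut (suc j)
  cut-mono zero    _ = s≤s z≤n
  cut-mono (suc j) _ = s≤s (fits-mono xs (*-monoˡ-≤ T (n≤1+n (suc j))))

  partitioning : Partitioning (suc q) (length xs)
  partitioning = record
    { sep       = cut
    ; sep-first = refl
    ; sep-last  = cong suc (fits-all (suc q * T) xs S≤pT)
    ; sep-mono  = cut-mono
    }

  -- Block 0 has sum ≤ T; block j+1 lies between the cuts at (j+1)T and (j+2)T.
  block≤T+M : ∀ j → blockSum xs (cut j) (cut (suc j)) ≤ T + M
  block≤T+M zero    = ≤-trans (fits-sum≤ (1 * T) xs) (+-monoʳ-≤ T z≤n)
  block≤T+M (suc j) = greedy-block xs (fits-mono xs (*-monoˡ-≤ T (n≤1+n (suc j))))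
                        (fits-sum≤ (suc (suc j) * T) xs) (fits-maximal (suc j * T) xs)

  bottleneck≤T+M : bottleneck (suc q) xs partitioning ≤ T + M
  bottleneck≤T+M = maxUpTo-≤ (λ j → blockSum xs (cut j) (cut (suc j))) (suc q) (λ j _ → block≤T+M j)

partB-feasible : ∀ q xs → AtLeastOpt (suc q) xs (answer partB (suc q) xs)
partB-feasible q xs =
  Greedy.partitioning q xs T S≤pT ,
  subst (bottleneck (suc q) xs (Greedy.partitioning q xs T S≤pT) ≤_)
        (sym (answer-partB (suc q) xs)) (Greedy.bottleneck≤T+M q xs T S≤pT)
  where
    T : ℕ
    T = ceilDiv (sum xs) (suc q)
    S≤pT : sum xs ≤ suc q * T
    S≤pT = ceilDiv-covers q (sum xs)

partB-within-twice : ∀ q xs → AtMostTwiceOpt (suc q) xs (answer partB (suc q) xs)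
partB-within-twice q xs P = begin
  answer partB (suc q) xs               ≡⟨ answer-partB (suc q) xs ⟩
  ceilDiv (sum xs) (suc q) + maxElem xs ≤⟨ +-mono-≤ (ceilDiv-least q (sum xs) β sum≤p*β) maxElem≤β ⟩
  β + β                                 ≡⟨ cong (β +_) (+-identityʳ β) ⟨
  2 * β                                 ∎
  where
    open ≤-Reasoning
    open LowerBound xs P using (β; sum≤p*β; maxElem≤β)

-- Theorem 5.  The algorithm partB with space constant 8 (only p ≥ 1 is used).
theorem5 : Σ StreamAlg λ A → Σ ℕ λ c →
             (p : ℕ) (xs : List ℕ) → 2 ≤ p → 1 ≤ length xs →
               (AtLeastOpt p xs (answer A p xs)
                 × AtMostTwiceOpt p xs (answer A p xs))
               × SpaceBound A c p xs
theorem5 = partB , 8 , guarantees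
  where
    guarantees : (p : ℕ) (xs : List ℕ) → 2 ≤ p → 1 ≤ length xs →
      (AtLeastOpt p xs (answer partB p xs) × AtMostTwiceOpt p xs (answer partB p xs))
      × SpaceBound partB 8 p xs
    guarantees (suc q) xs _ _ =
      (partB-feasible q xs , partB-within-twice q xs) , partB-space (suc q) xs
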